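{- Let $m\ge 3$ be an integer and fix a color $c\in\mathbb Z_5$. Suppose that for each layer $t\in\mathbb Z_m$ a function $d_t(\cdot,c):A_m\to\mathbb Z_5$ is given, and let the color class $E_c$ be the spanning subdigraph of $D_5(m)$ with arc set \[ E_c=\bigl\{\bigl(x,\ x+e_{d_{\sigma(x)}(\iota_{\sigma(x)}x,\,c)}\bigr):x\in(\mathbb Z_m)^5\bigr\}. \] Define the layer maps $P_{t,c}:A_m\to A_m$ by $P_{t,c}(w)=w+q_{d_t(w,c)}$ and the return map $R_c=P_{m-1,c}\circ\cdots\circ P_{1,c}\circ P_{0,c}$. Assume every layer map $P_{t,c}$ ($t\in\mathbb Z_m$) is a bijection. Then $E_c$ is a directed Hamilton cycle of $D_5(m)$ if and only if $R_c$ is a single cycle of length $m^4$ on $A_m$.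
   Context: $D_5(m)=\operatorname{Cay}((\mathbb Z_m)^5,\{e_0,\dots,e_4\})$ is the digraph on $(\mathbb Z_m)^5$ with arcs $x\to x+e_i$, where $e_i$ are the standard basis vectors. Let $A_m=\{w\in(\mathbb Z_m)^5:\sum_{i=0}^4 w_i=0\}$ (so $|A_m|=m^4$), $q_i=e_i-e_4$ for $i=0,1,2,3$ and $q_4=0$. Let $\sigma(x)=x_0+\dots+x_4\in\mathbb Z_m$, and for $x$ with $\sigma(x)=t$ put $\iota_t(x)=x-te_4\in A_m$ (a bijection from $\{x:\sigma(x)=t\}$ onto $A_m$). Color indices are read in $\mathbb Z_5$. -}

module Defs where

open import Data.Nat as ℕ using (ℕ; zero; suc; NonZero; _%_)
open import Data.Nat.Properties as ℕP using (+-comm; +-assoc; +-identityʳ; m∸n+n≡m; <⇒≤)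
open import Data.Nat.DivMod using (_mod_; m%n%n≡m%n; %-distribˡ-+; n%n≡0; m<n⇒m%n≡m)
open import Data.Fin as Fin using (Fin; toℕ; zero; suc)
open import Data.Fin.Properties using (toℕ-fromℕ<; toℕ<n; toℕ-injective)
open import Data.Vec as Vec using (Vec; []; _∷_; zipWith; map; sum)
open import Data.List as List using (List; allFin)
open import Data.Product using (Σ; ∃; ∃-syntax; _×_; _,_; proj₁)
open import Function.Bundles using (_⇔_)
import Function.Definitions as FD
open import Relation.Binary.PropositionalEquality

next : ∀ {n} → Fin n → Fin n
next {suc n} i = suc (toℕ i) mod suc n

Bijective : ∀ {A B : Set} → (A → B) → Set
Bijective = FD.Bijective _≡_ _≡_

IsSingleCycle : {X : Set} (N : ℕ) → (X → X) → Set
IsSingleCycle {X} N f =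
  ∃[ v ] (Bijective {Fin N} {X} v × (∀ i → f (v i) ≡ v (next i)))

IsHamiltonCycle : {V : Set} (N : ℕ) → (V → V → Set) → Set
IsHamiltonCycle {V} N Arc =
  ∃[ v ] (Bijective {Fin N} {V} v ×
          (∀ x y → Arc x y ⇔ (∃[ i ] (x ≡ v i × y ≡ v (next i)))))

fin4 : Fin 5
fin4 = suc (suc (suc (suc zero)))

module Setting (m : ℕ) {{nz : NonZero m}} where

  Zm : Set
  Zm = Fin m

  0ₘ 1ₘ : Zm
  0ₘ = 0 mod m
  1ₘ = 1 mod m

  _⊕_ : Zm → Zm → Zm
  a ⊕ b = (toℕ a ℕ.+ toℕ b) mod m

  ⊖_ : Zm → Zm
  ⊖ a = (m ℕ.∸ toℕ a) mod m

  V : Set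
  V = Vec Zm 5

  _+ᵥ_ : V → V → V
  _+ᵥ_ = zipWith _⊕_

  negᵥ : ∀ {n} → Vec Zm n → Vec Zm n
  negᵥ = map ⊖_

  _−ᵥ_ : V → V → V
  x −ᵥ y = x +ᵥ negᵥ y

  e : Fin 5 → V
  e zero = 1ₘ ∷ 0ₘ ∷ 0ₘ ∷ 0ₘ ∷ 0ₘ ∷ []
  e (suc zero) = 0ₘ ∷ 1ₘ ∷ 0ₘ ∷ 0ₘ ∷ 0ₘ ∷ []
  e (suc (suc zero)) = 0ₘ ∷ 0ₘ ∷ 1ₘ ∷ 0ₘ ∷ 0ₘ ∷ []
  e (suc (suc (suc zero))) = 0ₘ ∷ 0ₘ ∷ 0ₘ ∷ 1ₘ ∷ 0ₘ ∷ []
  e (suc (suc (suc (suc zero)))) = 0ₘ ∷ 0ₘ ∷ 0ₘ ∷ 0ₘ ∷ 1ₘ ∷ []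

  tE4 : Zm → V
  tE4 t = 0ₘ ∷ 0ₘ ∷ 0ₘ ∷ 0ₘ ∷ t ∷ []

  -- q_i = e_i − e_4 (so q_4 = e_4 − e_4 = 0)
  q : Fin 5 → V
  q i = e i −ᵥ e fin4

  S : ∀ {n} → Vec Zm n → ℕ
  S x = sum (map toℕ x)

  σ : V → Zm
  σ x = S x mod m

  A : Set
  A = Σ V (λ w → σ w ≡ 0ₘ)

  private
    _≈_ : ℕ → ℕ → Set
    a ≈ b = a % m ≡ b % m

    tm : ∀ n → toℕ (n mod m) ≡ n % m
    tm n = toℕ-fromℕ< _

    0%m : 0 % m ≡ 0
    0%m = m<n⇒m%n≡m (ℕ.>-nonZero⁻¹ m)

    z0 : toℕ 0ₘ ≡ 0
    z0 = trans (tm 0) 0%m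

    ≈-trans : ∀ {a b c} → a ≈ b → b ≈ c → a ≈ c
    ≈-trans = trans

    +≈ : ∀ {a a′ b b′} → a ≈ a′ → b ≈ b′ → (a ℕ.+ b) ≈ (a′ ℕ.+ b′)
    +≈ {a} {a′} {b} {b′} p r = begin
      (a ℕ.+ b) % m ≡⟨ %-distribˡ-+ a b m ⟩
      (a % m ℕ.+ b % m) % m ≡⟨ cong₂ (λ u v → (u ℕ.+ v) % m) p r ⟩
      (a′ % m ℕ.+ b′ % m) % m ≡⟨ sym (%-distribˡ-+ a′ b′ m) ⟩
      (a′ ℕ.+ b′) % m ∎
      where open ≡-Reasoning

    ≡⇒≈ : ∀ {a b} → a ≡ b → a ≈ b
    ≡⇒≈ p = cong (_% m) p

    rearr : ∀ a b c d → (a ℕ.+ c) ℕ.+ (b ℕ.+ d) ≡ (a ℕ.+ b) ℕ.+ (c ℕ.+ d)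
    rearr a b c d = begin
      (a ℕ.+ c) ℕ.+ (b ℕ.+ d) ≡⟨ +-assoc a c (b ℕ.+ d) ⟩
      a ℕ.+ (c ℕ.+ (b ℕ.+ d)) ≡⟨ cong (a ℕ.+_) (sym (+-assoc c b d)) ⟩
      a ℕ.+ ((c ℕ.+ b) ℕ.+ d) ≡⟨ cong (λ u → a ℕ.+ (u ℕ.+ d)) (+-comm c b) ⟩
      a ℕ.+ ((b ℕ.+ c) ℕ.+ d) ≡⟨ cong (a ℕ.+_) (+-assoc b c d) ⟩
      a ℕ.+ (b ℕ.+ (c ℕ.+ d)) ≡⟨ sym (+-assoc a b (c ℕ.+ d)) ⟩
      (a ℕ.+ b) ℕ.+ (c ℕ.+ d) ∎
      where open ≡-Reasoning

    S+ : ∀ {n} (x y : Vec Zm n) → S (zipWith _⊕_ x y) ≈ (S x ℕ.+ S y)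
    S+ [] [] = refl
    S+ (a ∷ x) (b ∷ y) =
      ≈-trans (+≈ {toℕ (a ⊕ b)} {toℕ a ℕ.+ toℕ b}
                  (trans (cong (_% m) (tm (toℕ a ℕ.+ toℕ b)))
                         (m%n%n≡m%n (toℕ a ℕ.+ toℕ b) m))
                  (S+ x y))
              (≡⇒≈ (rearr (toℕ a) (S x) (toℕ b) (S y)))

    negcell : ∀ (a : Zm) → (toℕ (⊖ a) ℕ.+ toℕ a) ≈ 0
    negcell a = begin
      (toℕ (⊖ a) ℕ.+ toℕ a) % m
        ≡⟨ +≈ {toℕ (⊖ a)} {m ℕ.∸ toℕ a} {toℕ a} {toℕ a}
              (trans (cong (_% m) (tm (m ℕ.∸ toℕ a))) (m%n%n≡m%n (m ℕ.∸ toℕ a) m)) refl ⟩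
      (m ℕ.∸ toℕ a ℕ.+ toℕ a) % m ≡⟨ cong (_% m) (m∸n+n≡m (<⇒≤ (toℕ<n a))) ⟩
      m % m ≡⟨ n%n≡0 m ⟩
      0 ≡⟨ sym 0%m ⟩
      0 % m ∎
      where open ≡-Reasoning

    Sneg : ∀ {n} (y : Vec Zm n) → (S (negᵥ y) ℕ.+ S y) ≈ 0
    Sneg [] = refl
    Sneg (a ∷ y) =
      ≈-trans (≡⇒≈ (rearr (toℕ (⊖ a)) (toℕ a) (S (negᵥ y)) (S y)))
              (+≈ {_} {0} {_} {0} (negcell a) (Sneg y))

    S− : ∀ (x y : V) → S (x −ᵥ y) ≈ (S x ℕ.+ S (negᵥ y))
    S− x y = S+ x (negᵥ y)

    toσ : ∀ x → S x ≈ toℕ (σ x)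
    toσ x = sym (trans (cong (_% m) (tm (S x))) (m%n%n≡m%n (S x) m))

    fromS : ∀ x → S x ≈ 0 → σ x ≡ 0ₘ
    fromS x p = toℕ-injective (trans (tm (S x)) (trans p (sym (tm 0))))

    StE4 : ∀ t → S (tE4 t) ≡ toℕ t
    StE4 t rewrite z0 = +-identityʳ (toℕ t)

    Se : ∀ i → S (e i) ≡ toℕ 1ₘ
    Se zero rewrite z0 = +-identityʳ _
    Se (suc zero) rewrite z0 = +-identityʳ _
    Se (suc (suc zero)) rewrite z0 = +-identityʳ _
    Se (suc (suc (suc zero))) rewrite z0 = +-identityʳ _
    Se (suc (suc (suc (suc zero)))) rewrite z0 = +-identityʳ _

    swap0 : ∀ (y : V) → (S y ℕ.+ S (negᵥ y)) ≈ 0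
    swap0 y = ≈-trans (≡⇒≈ (+-comm (S y) (S (negᵥ y)))) (Sneg y)

  ι-ok : ∀ (t : Zm) (x : V) → σ x ≡ t → σ (x −ᵥ tE4 t) ≡ 0ₘ
  ι-ok t x p = fromS (x −ᵥ tE4 t)
    (≈-trans (S− x (tE4 t))
      (≈-trans (+≈ {S x} {S (tE4 t)} {S (negᵥ (tE4 t))} {S (negᵥ (tE4 t))}
                   (≈-trans (toσ x) (≡⇒≈ (trans (cong toℕ p) (sym (StE4 t))))) refl)
               (swap0 (tE4 t))))

  q-ok : ∀ (w : V) i → σ (w +ᵥ q i) ≡ σ w
  q-ok w i = toℕ-injective (trans (tm _) (trans lem (sym (tm _))))
    where
    lem : S (w +ᵥ q i) ≈ S w
    lem = ≈-trans (S+ w (q i))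
           (≈-trans (+≈ {S w} {S w} {S (q i)} {0} refl
                       (≈-trans (S− (e i) (e fin4))
                         (≈-trans (+≈ {S (e i)} {S (e fin4)} {S (negᵥ (e fin4))} {S (negᵥ (e fin4))}
                                      (≡⇒≈ (trans (Se i) (sym (Se fin4)))) refl)
                                  (swap0 (e fin4)))))
                    (≡⇒≈ (+-identityʳ (S w))))

  ι : (t : Zm) (x : V) → σ x ≡ t → A
  ι t x p = (x −ᵥ tE4 t) , ι-ok t x p

  -- The data d_t(w, c): d : ℤ_m → A_m → ℤ_5 → ℤ_5  (d t w c = d_t(w,c))
  Coloring : Set
  Coloring = Zm → A → Fin 5 → Fin 5

  EArc : Coloring → Fin 5 → V → V → Set
  EArc d c x y = y ≡ x +ᵥ e (d (σ x) (ι (σ x) x refl) c)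

  P : Coloring → Fin 5 → Zm → A → A
  P d c t (w , p) = (w +ᵥ q (d t (w , p) c)) , trans (q-ok w (d t (w , p) c)) p

  composeLayers : Coloring → Fin 5 → List Zm → A → A
  composeLayers d c List.[] w = w
  composeLayers d c (t List.∷ ts) w = composeLayers d c ts (P d c t w)

  R : Coloring → Fin 5 → A → A
  R d c = composeLayers d c (allFin m)

-- E_c is the functional digraph of the successor map x ↦ x + e_{d(σ x, ι x, c)}, so it is a
-- Hamilton cycle exactly when that map is a single cycle on all m⁵ vertices.  Splitting a vertex
-- into its layer σ x and its position ι_{σ x} x ∈ A_m conjugates the successor map to the layered
-- map (t , w) ↦ (t + 1 , P_t w) on ℤ_m × A_m, whose m-th iterate on layer 0 is R_c.  Indexing the
-- orbit of (0 , w) by k·m + r, its r-th layer is the orbit of w under R_c followed by the bijection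
-- P_{r-1} ∘ ⋯ ∘ P_0; hence that orbit is a single cycle of length m · m⁴ iff the orbit of w under
-- R_c is a single cycle of length m⁴.

module Submission where

open import Defs
open import Data.Nat using (ℕ; NonZero; _≤_; _^_)
open import Data.Fin using (Fin)
open import Function.Bundles using (_⇔_)

open import Algebra.Bundles using (AbelianGroup)
open import Algebra.Consequences.Propositional using (comm∧idˡ⇒id; comm∧invˡ⇒inv)
import Algebra.Properties.AbelianGroup as AbelianGroupProperties
import Algebra.Properties.CommutativeSemigroup as CommutativeSemigroupProperties
open import Axiom.UniquenessOfIdentityProofs using (module Decidable⇒UIP)
open import Data.Fin as Fin using (toℕ; combine; remQuot)
open import Data.Fin.Patterns using (0F)
open import Data.Fin.Properties
  using (toℕ-fromℕ<; toℕ<n; toℕ-injective; toℕ-combine; remQuot-combine; combine-remQuot)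
open import Data.List as List using (List; []; _∷_; allFin; tabulate)
open import Data.Nat using (zero; suc; pred; _+_; _*_; _∸_; _%_; >-nonZero⁻¹)
open import Data.Nat.DivMod using (_mod_; _/_; %-distribˡ-+; m%n%n≡m%n; n%n≡0; m<n⇒m%n≡m; m≡m%n+[m/n]*n)
open import Data.Nat.GeneralisedArithmetic using (iterate)
open import Data.Nat.Properties
  using (+-comm; +-assoc; +-suc; +-identityʳ; *-comm; m∸n+n≡m; <⇒≤; suc-pred; m*n≢0; m^n≢0)
open import Data.Product using (∃; _×_; _,_; proj₁; proj₂; uncurry)
open import Data.Product.Function.NonDependent.Propositional using (_×-⇔_)
open import Data.Product.Properties using (,-injectiveˡ; ,-injectiveʳ)
open import Data.Unit using (tt)
open import Data.Vec using (Vec; []; _∷_; zipWith)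
open import Function using (_∘_; id)
open import Function.Bundles using (mk⇔; Equivalence)
open import Function.Consequences using (surjective⇒strictlySurjective)
open import Function.Consequences.Propositional using (strictlySurjective⇒surjective)
import Function.Construct.Composition as Composition
import Function.Construct.Identity as Identity
open import Function.Definitions using (Injective; StrictlySurjective)
import Function.Properties.Equivalence as ⇔
open import Level using (0ℓ)
import Relation.Binary.Reasoning.Setoid as SetoidReasoning
open import Relation.Binary.PropositionalEquality
open import Relation.Binary.PropositionalEquality.Algebra using (isMagma)

module EquivalenceReasoning = SetoidReasoning (⇔.⇔-setoid 0ℓ)

module _ {A B : Set} where

  bijective : {f : A → B} → Injective _≡_ _≡_ f → StrictlySurjective _≡_ f → Bijective f
  bijective inj surj = inj , strictlySurjective⇒surjective surj

  bijective⇒strictlySurjective : {f : A → B} → Bijective f → StrictlySurjective _≡_ f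
  bijective⇒strictlySurjective (_ , surj) = surjective⇒strictlySurjective _≡_ refl surj

  bijective-resp-≗ : {f g : A → B} → f ≗ g → Bijective f → Bijective g
  bijective-resp-≗ {f} {g} f≗g bij@(inj , _) =
    bijective (λ {x} {y} gx≡gy → inj (trans (f≗g x) (trans gx≡gy (sym (f≗g y)))))
              (λ b → let (a , fa≡b) = bijective⇒strictlySurjective bij b
                     in a , trans (sym (f≗g a)) fa≡b)

  inverse⇒bijective : {f : A → B} (g : B → A) → (∀ a → g (f a) ≡ a) → (∀ b → f (g b) ≡ b) → Bijective f
  inverse⇒bijective {f} g gf≡id fg≡id =
    bijective (λ {x} {y} fx≡fy → trans (sym (gf≡id x)) (trans (cong g fx≡fy) (gf≡id y)))
              (λ b → g b , fg≡id b)

∘-bijective : {A B C : Set} {f : B → C} {g : A → B} → Bijective g → Bijective f → Bijective (f ∘ g)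
∘-bijective = Composition.bijective _≡_ _≡_ _≡_

∘-bijective⇔ : {A B C : Set} {f : B → C} {g : A → B} (g⁻¹ : B → A) →
               (∀ a → g⁻¹ (g a) ≡ a) → (∀ b → g (g⁻¹ b) ≡ b) →
               Bijective (f ∘ g) ⇔ Bijective f
∘-bijective⇔ {f = f} {g} g⁻¹ g⁻¹g≡id gg⁻¹≡id = mk⇔
  (λ fg-bij → bijective-resp-≗ (cong f ∘ gg⁻¹≡id)
                (∘-bijective (inverse⇒bijective g gg⁻¹≡id g⁻¹g≡id) fg-bij))
  (∘-bijective (inverse⇒bijective g⁻¹ g⁻¹g≡id gg⁻¹≡id))

module _ {I J Y : Set} (h : I → J → Y) where

  fibrewise : J × I → I × Y
  fibrewise (j , i) = i , h i j

  fibrewise-bijective⇔ : Bijective fibrewise ⇔ (∀ i → Bijective (h i))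
  fibrewise-bijective⇔ = mk⇔ fibres-bijective total-bijective
    where
    fibres-bijective : Bijective fibrewise → ∀ i → Bijective (h i)
    fibres-bijective bij i = bijective
      (λ hij≡hij′ → ,-injectiveˡ (proj₁ bij (cong (i ,_) hij≡hij′)))
      (λ y → let ((j , i′) , eq) = bijective⇒strictlySurjective bij (i , y)
             in j , subst (λ k → h k j ≡ y) (,-injectiveˡ eq) (,-injectiveʳ eq))

    total-bijective : (∀ i → Bijective (h i)) → Bijective fibrewise
    total-bijective bij = bijective injective
      (λ (i , y) → let (j , hij≡y) = bijective⇒strictlySurjective (bij i) y
                   in (j , i) , cong (i ,_) hij≡y)
      where
      injective : Injective _≡_ _≡_ fibrewise
      injective {j , i} {j′ , i′} eq with ,-injectiveˡ eq
      ... | refl = cong (_, i) (proj₁ (bij i) (,-injectiveʳ eq))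

toℕ-next : ∀ {N} .{{_ : NonZero N}} (i : Fin N) → toℕ (next i) ≡ suc (toℕ i) % N
toℕ-next {suc _} i = toℕ-fromℕ< _

module _ {N : ℕ} .{{_ : NonZero N}} where

  0%n≡0 : 0 % N ≡ 0
  0%n≡0 = m<n⇒m%n≡m (>-nonZero⁻¹ N)

  [1+m%n]%n≡[1+m]%n : ∀ m → suc (m % N) % N ≡ suc m % N
  [1+m%n]%n≡[1+m]%n m = begin
    suc (m % N) % N            ≡⟨ %-distribˡ-+ 1 (m % N) N ⟩
    (1 % N + m % N % N) % N    ≡⟨ cong (λ k → (1 % N + k) % N) (m%n%n≡m%n m N) ⟩
    (1 % N + m % N) % N        ≡⟨ %-distribˡ-+ 1 m N ⟨
    suc m % N                  ∎
    where open ≡-Reasoning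

  toℕ-mod : ∀ n → toℕ (n mod N) ≡ n % N
  toℕ-mod n = toℕ-fromℕ< _

  mod-toℕ : ∀ (i : Fin N) → toℕ i mod N ≡ i
  mod-toℕ i = toℕ-injective (trans (toℕ-mod (toℕ i)) (m<n⇒m%n≡m (toℕ<n i)))

  n-mod-n≡0-mod-n : N mod N ≡ 0 mod N
  n-mod-n≡0-mod-n = toℕ-injective (begin
    toℕ (N mod N)  ≡⟨ toℕ-mod N ⟩
    N % N          ≡⟨ n%n≡0 N ⟩
    0              ≡⟨ 0%n≡0 ⟨
    0 % N          ≡⟨ toℕ-mod 0 ⟨
    toℕ (0 mod N)  ∎)
    where open ≡-Reasoning

  next-mod : ∀ n → next (n mod N) ≡ suc n mod N
  next-mod n = toℕ-injective (begin
    toℕ (next (n mod N))   ≡⟨ toℕ-next (n mod N) ⟩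
    suc (toℕ (n mod N)) % N ≡⟨ cong (λ k → suc k % N) (toℕ-mod n) ⟩
    suc (n % N) % N        ≡⟨ [1+m%n]%n≡[1+m]%n n ⟩
    suc n % N              ≡⟨ toℕ-mod (suc n) ⟨
    toℕ (suc n mod N)      ∎)
    where open ≡-Reasoning

  iterate-next-mod : ∀ n k → iterate next (n mod N) k ≡ (n + k) mod N
  iterate-next-mod n zero    = cong (_mod N) (sym (+-identityʳ n))
  iterate-next-mod n (suc k) = begin
    iterate next (next (n mod N)) k  ≡⟨ cong (λ i → iterate next i k) (next-mod n) ⟩
    iterate next (suc n mod N) k     ≡⟨ iterate-next-mod (suc n) k ⟩
    (suc n + k) mod N                ≡⟨ cong (_mod N) (+-suc n k) ⟨
    (n + suc k) mod N                ∎
    where open ≡-Reasoning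

module _ {X : Set} (f : X → X) where

  iterate-suc : ∀ x n → iterate f x (suc n) ≡ f (iterate f x n)
  iterate-suc x zero    = refl
  iterate-suc x (suc n) = iterate-suc (f x) n

  iterate-+ : ∀ x a b → iterate f x (a + b) ≡ iterate f (iterate f x a) b
  iterate-+ x zero    b = refl
  iterate-+ x (suc a) b = iterate-+ (f x) a b

  iterate-comm : ∀ x a b → iterate f (iterate f x a) b ≡ iterate f (iterate f x b) a
  iterate-comm x a b = begin
    iterate f (iterate f x a) b  ≡⟨ iterate-+ x a b ⟨
    iterate f x (a + b)          ≡⟨ cong (iterate f x) (+-comm a b) ⟩
    iterate f x (b + a)          ≡⟨ iterate-+ x b a ⟩
    iterate f (iterate f x b) a  ∎
    where open ≡-Reasoning

  Periodic : ℕ → X → Set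
  Periodic N x = iterate f x N ≡ x

  orbit : (N : ℕ) → X → Fin N → X
  orbit N x i = iterate f x (toℕ i)

  GeneratesCycle : ℕ → X → Set
  GeneratesCycle N x = Periodic N x × Bijective (orbit N x)

  periodic-iterate : ∀ {N x} → Periodic N x → ∀ a → Periodic N (iterate f x a)
  periodic-iterate {N} {x} periodic a =
    trans (iterate-comm x a N) (cong (λ y → iterate f y a) periodic)

  periodic-* : ∀ {N x} → Periodic N x → ∀ k → iterate f x (k * N) ≡ x
  periodic-*         periodic zero    = refl
  periodic-* {N} {x} periodic (suc k) = begin
    iterate f x (N + k * N)           ≡⟨ iterate-+ x N (k * N) ⟩
    iterate f (iterate f x N) (k * N) ≡⟨ cong (λ y → iterate f y (k * N)) periodic ⟩
    iterate f x (k * N)               ≡⟨ periodic-* periodic k ⟩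
    x                                 ∎
    where open ≡-Reasoning

  module _ {N : ℕ} .{{_ : NonZero N}} {x : X} (periodic : Periodic N x) where

    periodic-% : ∀ n → iterate f x n ≡ iterate f x (n % N)
    periodic-% n = begin
      iterate f x n                               ≡⟨ cong (iterate f x) (m≡m%n+[m/n]*n n N) ⟩
      iterate f x (n % N + n / N * N)             ≡⟨ iterate-+ x (n % N) (n / N * N) ⟩
      iterate f (iterate f x (n % N)) (n / N * N) ≡⟨ periodic-* (periodic-iterate {N} periodic (n % N)) (n / N) ⟩
      iterate f x (n % N)                         ∎
      where open ≡-Reasoning

    periodic-return : ∀ j → iterate f (iterate f x j) (pred N * j) ≡ x
    periodic-return j = begin
      iterate f (iterate f x j) (pred N * j)  ≡⟨ iterate-+ x j (pred N * j) ⟨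
      iterate f x (suc (pred N) * j)          ≡⟨ cong (λ n → iterate f x (n * j)) (suc-pred N) ⟩
      iterate f x (N * j)                     ≡⟨ cong (iterate f x) (*-comm N j) ⟩
      iterate f x (j * N)                     ≡⟨ periodic-* periodic j ⟩
      x                                       ∎
      where open ≡-Reasoning

  module _ {N : ℕ} .{{_ : NonZero N}} where

    generatesCycle-iterate : ∀ {x} → GeneratesCycle N x → ∀ j → GeneratesCycle N (iterate f x j)
    generatesCycle-iterate {x} (periodic , orbit-bijective) j =
      periodic-iterate {N} periodic j , bijective injective surjective
      where
      x′ = iterate f x j
      c = pred N * j

      x′-reaches-x : ∀ n → iterate f (iterate f x′ n) c ≡ iterate f x n
      x′-reaches-x n = begin
        iterate f (iterate f x′ n) c  ≡⟨ iterate-comm x′ n c ⟩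
        iterate f (iterate f x′ c) n  ≡⟨ cong (λ y → iterate f y n) (periodic-return periodic j) ⟩
        iterate f x n                 ∎
        where open ≡-Reasoning

      injective : Injective _≡_ _≡_ (orbit N x′)
      injective {a} {b} eq = proj₁ orbit-bijective (begin
        iterate f x (toℕ a)                  ≡⟨ x′-reaches-x (toℕ a) ⟨
        iterate f (iterate f x′ (toℕ a)) c   ≡⟨ cong (λ y → iterate f y c) eq ⟩
        iterate f (iterate f x′ (toℕ b)) c   ≡⟨ x′-reaches-x (toℕ b) ⟩
        iterate f x (toℕ b)                  ∎)
        where open ≡-Reasoning

      surjective : StrictlySurjective _≡_ (orbit N x′)
      surjective y = (toℕ i + c) mod N , (begin
        iterate f x′ (toℕ ((toℕ i + c) mod N))  ≡⟨ cong (iterate f x′) (toℕ-mod (toℕ i + c)) ⟩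
        iterate f x′ ((toℕ i + c) % N)          ≡⟨ periodic-% (periodic-iterate {N} periodic j) (toℕ i + c) ⟨
        iterate f x′ (toℕ i + c)                ≡⟨ iterate-+ x′ (toℕ i) c ⟩
        iterate f (iterate f x′ (toℕ i)) c      ≡⟨ x′-reaches-x (toℕ i) ⟩
        iterate f x (toℕ i)                     ≡⟨ proj₂ (bijective⇒strictlySurjective orbit-bijective y) ⟩
        y                                       ∎)
        where
        open ≡-Reasoning
        i = proj₁ (bijective⇒strictlySurjective orbit-bijective y)

    generatesCycle-everywhere : ∀ {x} → GeneratesCycle N x → ∀ y → GeneratesCycle N y
    generatesCycle-everywhere generates@(_ , orbit-bijective) y =
      let (i , orbit-i≡y) = bijective⇒strictlySurjective orbit-bijective y
      in subst (GeneratesCycle N) orbit-i≡y (generatesCycle-iterate generates (toℕ i))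

    generatesCycle⇒isSingleCycle : ∀ {x} → GeneratesCycle N x → IsSingleCycle N f
    generatesCycle⇒isSingleCycle {x} (periodic , orbit-bijective) =
      orbit N x , orbit-bijective , λ i → begin
        f (iterate f x (toℕ i))        ≡⟨ iterate-suc x (toℕ i) ⟨
        iterate f x (suc (toℕ i))      ≡⟨ periodic-% periodic (suc (toℕ i)) ⟩
        iterate f x (suc (toℕ i) % N)  ≡⟨ cong (iterate f x) (toℕ-next i) ⟨
        iterate f x (toℕ (next i))     ∎
      where open ≡-Reasoning

    isSingleCycle⇒generatesCycle : IsSingleCycle N f → ∃ (GeneratesCycle N)
    isSingleCycle⇒generatesCycle (v , v-bijective , v-step) =
      x₀ , periodic , bijective-resp-≗ v≗orbit v-bijective
      where
      open ≡-Reasoning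
      x₀ = v (0 mod N)

      v-mod : ∀ n → v (n mod N) ≡ iterate f x₀ n
      v-mod zero    = refl
      v-mod (suc n) = begin
        v (suc n mod N)       ≡⟨ cong v (next-mod n) ⟨
        v (next (n mod N))    ≡⟨ v-step (n mod N) ⟨
        f (v (n mod N))       ≡⟨ cong f (v-mod n) ⟩
        f (iterate f x₀ n)    ≡⟨ iterate-suc x₀ n ⟨
        iterate f x₀ (suc n)  ∎

      v≗orbit : v ≗ orbit N x₀
      v≗orbit i = trans (cong v (sym (mod-toℕ i))) (v-mod (toℕ i))

      periodic : Periodic N x₀
      periodic = trans (sym (v-mod N)) (cong v n-mod-n≡0-mod-n)

isSingleCycle-conjugate : ∀ {X Z : Set} {N} {f : X → X} {g : Z → Z} {φ : X → Z} → Bijective φ →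
  (∀ x → φ (f x) ≡ g (φ x)) → IsSingleCycle N f → IsSingleCycle N g
isSingleCycle-conjugate {φ = φ} φ-bijective φf≡gφ (v , v-bijective , v-step) =
  φ ∘ v , ∘-bijective v-bijective φ-bijective , λ i → trans (sym (φf≡gφ (v i))) (cong φ (v-step i))

module _ {X : Set} {N : ℕ} where

  isSingleCycle-resp-≗ : {f g : X → X} → f ≗ g → IsSingleCycle N f → IsSingleCycle N g
  isSingleCycle-resp-≗ f≗g (v , v-bijective , v-step) =
    v , v-bijective , λ i → trans (sym (f≗g (v i))) (v-step i)

  isHamiltonCycle-graph⇔isSingleCycle : (f : X → X) →
    IsHamiltonCycle N (λ x y → y ≡ f x) ⇔ IsSingleCycle N f
  isHamiltonCycle-graph⇔isSingleCycle f = mk⇔ to from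
    where
    to : IsHamiltonCycle N (λ x y → y ≡ f x) → IsSingleCycle N f
    to (v , v-bijective , arcs) = v , v-bijective , λ i →
      let (j , vi≡vj , fvi≡vnextj) = Equivalence.to (arcs (v i) (f (v i))) refl
      in trans fvi≡vnextj (cong (v ∘ next) (sym (proj₁ v-bijective vi≡vj)))

    from : IsSingleCycle N f → IsHamiltonCycle N (λ x y → y ≡ f x)
    from (v , v-bijective , v-step) = v , v-bijective , λ x y → mk⇔
      (λ y≡fx → let (i , vi≡x) = bijective⇒strictlySurjective v-bijective x
                in i , sym vi≡x , trans y≡fx (trans (cong f (sym vi≡x)) (v-step i)))
      (λ (i , x≡vi , y≡vnexti) → trans y≡vnexti (trans (sym (v-step i)) (cong f (sym x≡vi))))

module _ {X Z : Set} {N : ℕ} where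

  isSingleCycle-conjugate⇔ : {f : X → X} {g : Z → Z} (φ : X → Z) (φ⁻¹ : Z → X) →
    (∀ x → φ⁻¹ (φ x) ≡ x) → (∀ z → φ (φ⁻¹ z) ≡ z) → (∀ x → φ (f x) ≡ g (φ x)) →
    IsSingleCycle N f ⇔ IsSingleCycle N g
  isSingleCycle-conjugate⇔ {f} {g} φ φ⁻¹ φ⁻¹φ≡id φφ⁻¹≡id φf≡gφ = mk⇔
    (isSingleCycle-conjugate {g = g} (inverse⇒bijective φ⁻¹ φ⁻¹φ≡id φφ⁻¹≡id) φf≡gφ)
    (isSingleCycle-conjugate {g = f} (inverse⇒bijective φ φφ⁻¹≡id φ⁻¹φ≡id) φ⁻¹g≡fφ⁻¹)
    where
    φ⁻¹g≡fφ⁻¹ : ∀ z → φ⁻¹ (g z) ≡ f (φ⁻¹ z)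
    φ⁻¹g≡fφ⁻¹ z = begin
      φ⁻¹ (g z)              ≡⟨ cong (φ⁻¹ ∘ g) (φφ⁻¹≡id z) ⟨
      φ⁻¹ (g (φ (φ⁻¹ z)))    ≡⟨ cong φ⁻¹ (φf≡gφ (φ⁻¹ z)) ⟨
      φ⁻¹ (φ (f (φ⁻¹ z)))    ≡⟨ φ⁻¹φ≡id (f (φ⁻¹ z)) ⟩
      f (φ⁻¹ z)              ∎
      where open ≡-Reasoning

module _ {N : ℕ} {Y : Set} (P : Fin N → Y → Y) where

  layeredStep : Fin N × Y → Fin N × Y
  layeredStep (t , y) = next t , P t y

  runLayers : List (Fin N) → Y → Y
  runLayers []       y = y
  runLayers (t ∷ ts) y = runLayers ts (P t y)

  iterate-layeredStep : ∀ t y k →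
    iterate layeredStep (t , y) k ≡ (iterate next t k , runLayers (List.iterate next t k) y)
  iterate-layeredStep t y zero    = refl
  iterate-layeredStep t y (suc k) = iterate-layeredStep (next t) (P t y) k

  runLayers-bijective : (∀ t → Bijective (P t)) → ∀ ts → Bijective (runLayers ts)
  runLayers-bijective P-bijective []       = Identity.bijective _≡_
  runLayers-bijective P-bijective (t ∷ ts) =
    ∘-bijective (P-bijective t) (runLayers-bijective P-bijective ts)

module _ {m′ : ℕ} {Y : Set} (P : Fin (suc m′) → Y → Y) where

  private
    m = suc m′
    step = layeredStep P

  returnMap : Y → Y
  returnMap = runLayers P (allFin m)

  iterate-next-0F : ∀ (r : Fin m) → iterate next 0F (toℕ r) ≡ r
  iterate-next-0F r = trans (iterate-next-mod 0 (toℕ r)) (mod-toℕ r)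

  tabulate≡iterate-next : ∀ {k} (t : Fin m) (g : Fin k → Fin m) →
    (∀ i → g i ≡ iterate next t (toℕ i)) → tabulate g ≡ List.iterate next t k
  tabulate≡iterate-next {zero}  t g g≡ = refl
  tabulate≡iterate-next {suc k} t g g≡ =
    cong₂ _∷_ (g≡ 0F) (tabulate≡iterate-next (next t) (g ∘ Fin.suc) (g≡ ∘ Fin.suc))

  allFin≡iterate-next : allFin m ≡ List.iterate next 0F m
  allFin≡iterate-next = tabulate≡iterate-next 0F id (sym ∘ iterate-next-0F)

  iterate-layeredStep-m : ∀ y → iterate step (0F , y) m ≡ (0F , returnMap y)
  iterate-layeredStep-m y = trans (iterate-layeredStep P 0F y m)
    (cong₂ _,_ (trans (iterate-next-mod 0 m) n-mod-n≡0-mod-n)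
               (cong (λ ts → runLayers P ts y) (sym allFin≡iterate-next)))

  iterate-layeredStep-*m : ∀ y k → iterate step (0F , y) (k * m) ≡ (0F , iterate returnMap y k)
  iterate-layeredStep-*m y zero    = refl
  iterate-layeredStep-*m y (suc k) = begin
    iterate step (0F , y) (m + k * m)
      ≡⟨ iterate-+ step (0F , y) m (k * m) ⟩
    iterate step (iterate step (0F , y) m) (k * m)
      ≡⟨ cong (λ z → iterate step z (k * m)) (iterate-layeredStep-m y) ⟩
    iterate step (0F , returnMap y) (k * m)
      ≡⟨ iterate-layeredStep-*m (returnMap y) k ⟩
    (0F , iterate returnMap (returnMap y) k)
      ∎
    where open ≡-Reasoning

  firstLayers : Fin m → Y → Y
  firstLayers r = runLayers P (List.iterate next 0F (toℕ r))

  iterate-layeredStep-combine : ∀ {N} y (k : Fin N) (r : Fin m) →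
    iterate step (0F , y) (toℕ (combine k r)) ≡ (r , firstLayers r (iterate returnMap y (toℕ k)))
  iterate-layeredStep-combine y k r = begin
    iterate step (0F , y) (toℕ (combine k r))
      ≡⟨ cong (iterate step (0F , y)) index ⟩
    iterate step (0F , y) (toℕ k * m + toℕ r)
      ≡⟨ iterate-+ step (0F , y) (toℕ k * m) (toℕ r) ⟩
    iterate step (iterate step (0F , y) (toℕ k * m)) (toℕ r)
      ≡⟨ cong (λ z → iterate step z (toℕ r)) (iterate-layeredStep-*m y (toℕ k)) ⟩
    iterate step (0F , y′) (toℕ r)
      ≡⟨ iterate-layeredStep P 0F y′ (toℕ r) ⟩
    (iterate next 0F (toℕ r) , firstLayers r y′)
      ≡⟨ cong (_, firstLayers r y′) (iterate-next-0F r) ⟩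
    (r , firstLayers r y′)
      ∎
    where
    open ≡-Reasoning
    y′ = iterate returnMap y (toℕ k)
    index : toℕ (combine k r) ≡ toℕ k * m + toℕ r
    index = trans (toℕ-combine k r) (cong (_+ toℕ r) (*-comm m (toℕ k)))

  module _ (P-bijective : ∀ t → Bijective (P t)) where

    generatesCycle-layeredStep⇔ : ∀ {N} y →
      GeneratesCycle step (N * m) (0F , y) ⇔ GeneratesCycle returnMap N y
    generatesCycle-layeredStep⇔ {N} y = periodic⇔ ×-⇔ orbit-bijective⇔
      where
      periodic⇔ : Periodic step (N * m) (0F , y) ⇔ Periodic returnMap N y
      periodic⇔ = mk⇔
        (λ periodic → ,-injectiveʳ (trans (sym (iterate-layeredStep-*m y N)) periodic))
        (λ periodic → trans (iterate-layeredStep-*m y N) (cong (0F ,_) periodic))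

      layerOrbit : Fin m → Fin N → Y
      layerOrbit r = firstLayers r ∘ orbit returnMap N y

      orbit∘combine≗fibrewise : orbit step (N * m) (0F , y) ∘ uncurry combine ≗ fibrewise layerOrbit
      orbit∘combine≗fibrewise (k , r) = iterate-layeredStep-combine y k r

      open EquivalenceReasoning
      orbit-bijective⇔ : Bijective (orbit step (N * m) (0F , y)) ⇔ Bijective (orbit returnMap N y)
      orbit-bijective⇔ = begin
        Bijective (orbit step (N * m) (0F , y))
          ≈⟨ ⇔.sym (∘-bijective⇔ (remQuot m) (uncurry remQuot-combine) (combine-remQuot {N} m)) ⟩
        Bijective (orbit step (N * m) (0F , y) ∘ uncurry combine)
          ≈⟨ mk⇔ (bijective-resp-≗ orbit∘combine≗fibrewise)
                 (bijective-resp-≗ (sym ∘ orbit∘combine≗fibrewise)) ⟩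
        Bijective (fibrewise layerOrbit)
          ≈⟨ fibrewise-bijective⇔ layerOrbit ⟩
        (∀ r → Bijective (layerOrbit r))
          ≈⟨ mk⇔ (λ layers-bijective → layers-bijective 0F)
                 (λ orbit-bijective r → ∘-bijective orbit-bijective
                   (runLayers-bijective P P-bijective (List.iterate next 0F (toℕ r)))) ⟩
        Bijective (orbit returnMap N y)
          ∎

    isSingleCycle-layeredStep⇔ : ∀ {N} .{{_ : NonZero N}} →
      IsSingleCycle (m * N) step ⇔ IsSingleCycle N returnMap
    isSingleCycle-layeredStep⇔ {N} =
      subst (λ M → IsSingleCycle M step ⇔ IsSingleCycle N returnMap) (*-comm N m) (mk⇔ to from)
      where
      instance _ = m*n≢0 N m

      to : IsSingleCycle (N * m) step → IsSingleCycle N returnMap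
      to single = let ((_ , y) , generates) = isSingleCycle⇒generatesCycle step single in
        generatesCycle⇒isSingleCycle returnMap (Equivalence.to (generatesCycle-layeredStep⇔ y)
          (generatesCycle-everywhere step generates (0F , y)))

      from : IsSingleCycle N returnMap → IsSingleCycle (N * m) step
      from single = let (y , generates) = isSingleCycle⇒generatesCycle returnMap single in
        generatesCycle⇒isSingleCycle step (Equivalence.from (generatesCycle-layeredStep⇔ y) generates)

module _ {m : ℕ} {{_ : NonZero m}} where

  open Setting m

  toℕ-0ₘ : toℕ 0ₘ ≡ 0
  toℕ-0ₘ = trans (toℕ-mod 0) 0%n≡0

  mod-+ : ∀ a b → (a + b) mod m ≡ (a mod m) ⊕ (b mod m)
  mod-+ a b = toℕ-injective (begin
    toℕ ((a + b) mod m)                  ≡⟨ toℕ-mod (a + b) ⟩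
    (a + b) % m                          ≡⟨ %-distribˡ-+ a b m ⟩
    (a % m + b % m) % m                  ≡⟨ cong₂ (λ u v → (u + v) % m) (toℕ-mod a) (toℕ-mod b) ⟨
    (toℕ (a mod m) + toℕ (b mod m)) % m  ≡⟨ toℕ-mod _ ⟨
    toℕ ((a mod m) ⊕ (b mod m))          ∎)
    where open ≡-Reasoning

  ⊕-comm : ∀ a b → a ⊕ b ≡ b ⊕ a
  ⊕-comm a b = cong (_mod m) (+-comm (toℕ a) (toℕ b))

  ⊕-assoc : ∀ a b c → (a ⊕ b) ⊕ c ≡ a ⊕ (b ⊕ c)
  ⊕-assoc a b c = begin
    (a ⊕ b) ⊕ c                              ≡⟨ cong ((a ⊕ b) ⊕_) (mod-toℕ c) ⟨
    ((toℕ a + toℕ b) mod m) ⊕ (toℕ c mod m)  ≡⟨ mod-+ (toℕ a + toℕ b) (toℕ c) ⟨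
    (toℕ a + toℕ b + toℕ c) mod m            ≡⟨ cong (_mod m) (+-assoc (toℕ a) (toℕ b) (toℕ c)) ⟩
    (toℕ a + (toℕ b + toℕ c)) mod m          ≡⟨ mod-+ (toℕ a) (toℕ b + toℕ c) ⟩
    (toℕ a mod m) ⊕ ((toℕ b + toℕ c) mod m)  ≡⟨ cong (_⊕ (b ⊕ c)) (mod-toℕ a) ⟩
    a ⊕ (b ⊕ c)                              ∎
    where open ≡-Reasoning

  ⊕-identityˡ : ∀ a → 0ₘ ⊕ a ≡ a
  ⊕-identityˡ a = trans (cong (λ n → (n + toℕ a) mod m) toℕ-0ₘ) (mod-toℕ a)

  ⊖-inverseˡ : ∀ a → (⊖ a) ⊕ a ≡ 0ₘ
  ⊖-inverseˡ a = begin
    (⊖ a) ⊕ a                            ≡⟨ cong ((⊖ a) ⊕_) (mod-toℕ a) ⟨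
    ((m ∸ toℕ a) mod m) ⊕ (toℕ a mod m)  ≡⟨ mod-+ (m ∸ toℕ a) (toℕ a) ⟨
    (m ∸ toℕ a + toℕ a) mod m            ≡⟨ cong (_mod m) (m∸n+n≡m (<⇒≤ (toℕ<n a))) ⟩
    m mod m                              ≡⟨ n-mod-n≡0-mod-n ⟩
    0ₘ                                   ∎
    where open ≡-Reasoning

  ℤₘ : AbelianGroup 0ℓ 0ℓ
  ℤₘ = record
    { _≈_ = _≡_ ; _∙_ = _⊕_ ; ε = 0ₘ ; _⁻¹ = ⊖_
    ; isAbelianGroup = record
      { isGroup = record
        { isMonoid = record
          { isSemigroup = record { isMagma = isMagma _⊕_ ; assoc = ⊕-assoc }
          ; identity = comm∧idˡ⇒id ⊕-comm ⊕-identityˡ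
          }
        ; inverse = comm∧invˡ⇒inv ⊕-comm ⊖-inverseˡ
        ; ⁻¹-cong = cong ⊖_
        }
      ; comm = ⊕-comm
      }
    }

  open AbelianGroupProperties ℤₘ using (//-rightDividesˡ; //-rightDividesʳ; ⁻¹-∙-comm)
  open CommutativeSemigroupProperties (AbelianGroup.commutativeSemigroup ℤₘ) using (interchange)

  zipWith-⊕-⊖-cancel : ∀ {n} (x y : Vec Zm n) → zipWith _⊕_ (zipWith _⊕_ x y) (negᵥ y) ≡ x
  zipWith-⊕-⊖-cancel []       []       = refl
  zipWith-⊕-⊖-cancel (a ∷ x) (b ∷ y) = cong₂ _∷_ (//-rightDividesʳ b a) (zipWith-⊕-⊖-cancel x y)

  zipWith-⊖-⊕-cancel : ∀ {n} (x y : Vec Zm n) → zipWith _⊕_ (zipWith _⊕_ x (negᵥ y)) y ≡ x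
  zipWith-⊖-⊕-cancel []       []       = refl
  zipWith-⊖-⊕-cancel (a ∷ x) (b ∷ y) = cong₂ _∷_ (//-rightDividesˡ b a) (zipWith-⊖-⊕-cancel x y)

  zipWith-⊕-⊖-interchange : ∀ {n} (x y u z : Vec Zm n) →
    zipWith _⊕_ (zipWith _⊕_ x y) (negᵥ (zipWith _⊕_ u z))
      ≡ zipWith _⊕_ (zipWith _⊕_ x (negᵥ u)) (zipWith _⊕_ y (negᵥ z))
  zipWith-⊕-⊖-interchange []       []       []       []       = refl
  zipWith-⊕-⊖-interchange (a ∷ x) (b ∷ y) (c ∷ u) (d ∷ z) = cong₂ _∷_
    (trans (cong ((a ⊕ b) ⊕_) (sym (⁻¹-∙-comm c d))) (interchange a b (⊖ c) (⊖ d)))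
    (zipWith-⊕-⊖-interchange x y u z)

  mod-toℕ-+ : ∀ (a : Zm) n → (toℕ a + n) mod m ≡ a ⊕ (n mod m)
  mod-toℕ-+ a n = trans (mod-+ (toℕ a) n) (cong (_⊕ (n mod m)) (mod-toℕ a))

  S-zipWith : ∀ {n} (x y : Vec Zm n) → S (zipWith _⊕_ x y) mod m ≡ (S x mod m) ⊕ (S y mod m)
  S-zipWith []       []       = sym (⊕-identityˡ 0ₘ)
  S-zipWith (a ∷ x) (b ∷ y) = begin
    (toℕ (a ⊕ b) + S (zipWith _⊕_ x y)) mod m    ≡⟨ mod-toℕ-+ (a ⊕ b) (S (zipWith _⊕_ x y)) ⟩
    (a ⊕ b) ⊕ (S (zipWith _⊕_ x y) mod m)        ≡⟨ cong ((a ⊕ b) ⊕_) (S-zipWith x y) ⟩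
    (a ⊕ b) ⊕ ((S x mod m) ⊕ (S y mod m))        ≡⟨ interchange a b (S x mod m) (S y mod m) ⟩
    (a ⊕ (S x mod m)) ⊕ (b ⊕ (S y mod m))        ≡⟨ cong₂ _⊕_ (mod-toℕ-+ a (S x)) (mod-toℕ-+ b (S y)) ⟨
    ((toℕ a + S x) mod m) ⊕ ((toℕ b + S y) mod m) ∎
    where open ≡-Reasoning

  σ-e : ∀ i → σ (e i) ≡ 1ₘ
  σ-e i = trans (cong (_mod m) (S-e i)) (mod-toℕ 1ₘ)
    where
    S-e : ∀ i → S (e i) ≡ toℕ 1ₘ
    S-e 0F                                 rewrite toℕ-0ₘ = +-identityʳ (toℕ 1ₘ)
    S-e (Fin.suc 0F)                       rewrite toℕ-0ₘ = +-identityʳ (toℕ 1ₘ)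
    S-e (Fin.suc (Fin.suc 0F))             rewrite toℕ-0ₘ = +-identityʳ (toℕ 1ₘ)
    S-e (Fin.suc (Fin.suc (Fin.suc 0F)))   rewrite toℕ-0ₘ = +-identityʳ (toℕ 1ₘ)
    S-e (Fin.suc (Fin.suc (Fin.suc (Fin.suc 0F)))) rewrite toℕ-0ₘ = +-identityʳ (toℕ 1ₘ)

  σ-tE4 : ∀ t → σ (tE4 t) ≡ t
  σ-tE4 t = trans (cong (_mod m) S-tE4) (mod-toℕ t)
    where
    S-tE4 : S (tE4 t) ≡ toℕ t
    S-tE4 rewrite toℕ-0ₘ = +-identityʳ (toℕ t)

  next≡⊕1ₘ : ∀ t → next t ≡ t ⊕ 1ₘ
  next≡⊕1ₘ t = begin
    next t                        ≡⟨ cong next (mod-toℕ t) ⟨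
    next (toℕ t mod m)            ≡⟨ next-mod (toℕ t) ⟩
    suc (toℕ t) mod m             ≡⟨ cong (_mod m) (+-comm 1 (toℕ t)) ⟩
    (toℕ t + 1) mod m             ≡⟨ mod-toℕ-+ t 1 ⟩
    t ⊕ 1ₘ                        ∎
    where open ≡-Reasoning

  tE4-next : ∀ t → tE4 (next t) ≡ tE4 t +ᵥ e fin4
  tE4-next t = cong₂ (λ z u → z ∷ z ∷ z ∷ z ∷ u ∷ []) (sym (⊕-identityˡ 0ₘ)) (next≡⊕1ₘ t)

  A-≡ : ∀ {w w′ : V} {p : σ w ≡ 0ₘ} {p′ : σ w′ ≡ 0ₘ} → w ≡ w′ → _≡_ {A = A} (w , p) (w′ , p′)
  A-≡ {p = p} {p′} refl = cong (_ ,_) (Decidable⇒UIP.≡-irrelevant Fin._≟_ p p′)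

  layered-≡ : ∀ {t t′ : Zm} {w w′ : V} {p : σ w ≡ 0ₘ} {p′ : σ w′ ≡ 0ₘ} →
    t ≡ t′ → w ≡ w′ → _≡_ {A = Zm × A} (t , (w , p)) (t′ , (w′ , p′))
  layered-≡ refl w≡w′ = cong (_ ,_) (A-≡ w≡w′)

  toLayered : V → Zm × A
  toLayered x = σ x , ι (σ x) x refl

  fromLayered : Zm × A → V
  fromLayered (t , (w , _)) = w +ᵥ tE4 t

  fromLayered-toLayered : ∀ x → fromLayered (toLayered x) ≡ x
  fromLayered-toLayered x = zipWith-⊖-⊕-cancel x (tE4 (σ x))

  toLayered-fromLayered : ∀ z → toLayered (fromLayered z) ≡ z
  toLayered-fromLayered (t , (w , σw≡0)) = layered-≡ σ≡t
    (trans (cong (λ t′ → (w +ᵥ tE4 t) −ᵥ tE4 t′) σ≡t) (zipWith-⊕-⊖-cancel w (tE4 t)))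
    where
    σ≡t : σ (w +ᵥ tE4 t) ≡ t
    σ≡t = trans (S-zipWith w (tE4 t)) (trans (cong₂ _⊕_ σw≡0 (σ-tE4 t)) (⊕-identityˡ t))

  module _ (d : Coloring) (c : Fin 5) where

    colourSuccessor : V → V
    colourSuccessor x = x +ᵥ e (d (σ x) (ι (σ x) x refl) c)

    toLayered-colourSuccessor : ∀ x →
      toLayered (colourSuccessor x) ≡ layeredStep (P d c) (toLayered x)
    toLayered-colourSuccessor x = layered-≡ σ≡next shifted
      where
      s = σ x
      j = d s (ι s x refl) c

      σ≡next : σ (x +ᵥ e j) ≡ next s
      σ≡next = trans (S-zipWith x (e j)) (trans (cong (s ⊕_) (σ-e j)) (sym (next≡⊕1ₘ s)))

      shifted : (x +ᵥ e j) −ᵥ tE4 (σ (x +ᵥ e j)) ≡ (x −ᵥ tE4 s) +ᵥ q j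
      shifted = begin
        (x +ᵥ e j) −ᵥ tE4 (σ (x +ᵥ e j))   ≡⟨ cong (λ t → (x +ᵥ e j) −ᵥ tE4 t) σ≡next ⟩
        (x +ᵥ e j) −ᵥ tE4 (next s)         ≡⟨ cong ((x +ᵥ e j) −ᵥ_) (tE4-next s) ⟩
        (x +ᵥ e j) −ᵥ (tE4 s +ᵥ e fin4)    ≡⟨ zipWith-⊕-⊖-interchange x (e j) (tE4 s) (e fin4) ⟩
        (x −ᵥ tE4 s) +ᵥ q j                ∎
        where open ≡-Reasoning

    runLayers≗composeLayers : ∀ ts → runLayers (P d c) ts ≗ composeLayers d c ts
    runLayers≗composeLayers []       w = refl
    runLayers≗composeLayers (t ∷ ts) w = runLayers≗composeLayers ts (P d c t w)

isHamiltonCycle-EArc⇔isSingleCycle-R : ∀ {m N} {{_ : NonZero m}} .{{_ : NonZero N}} →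
  (c : Fin 5) (d : Setting.Coloring m) → (∀ t → Bijective (Setting.P m d c t)) →
  IsHamiltonCycle (m * N) (Setting.EArc m d c) ⇔ IsSingleCycle N (Setting.R m d c)
-- Matching the instance replaces the instance variable by the canonical instance the lemmas above
-- are used with; otherwise the conversion checks in this proof become very slow.
isHamiltonCycle-EArc⇔isSingleCycle-R {m@(suc _)} {N} {{record { nonZero = tt }}} c d P-bijective = begin
  IsHamiltonCycle (m * N) (Setting.EArc m d c)
    ≈⟨ isHamiltonCycle-graph⇔isSingleCycle (colourSuccessor d c) ⟩
  IsSingleCycle (m * N) (colourSuccessor d c)
    ≈⟨ isSingleCycle-conjugate⇔ {g = layeredStep (Setting.P m d c)} toLayered fromLayered
         fromLayered-toLayered toLayered-fromLayered (toLayered-colourSuccessor d c) ⟩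
  IsSingleCycle (m * N) (layeredStep (Setting.P m d c))
    ≈⟨ isSingleCycle-layeredStep⇔ (Setting.P m d c) P-bijective ⟩
  IsSingleCycle N (returnMap (Setting.P m d c))
    ≈⟨ mk⇔ (isSingleCycle-resp-≗ (runLayers≗composeLayers d c (allFin m)))
           (isSingleCycle-resp-≗ (sym ∘ runLayers≗composeLayers d c (allFin m))) ⟩
  IsSingleCycle N (Setting.R m d c)
    ∎
  where open EquivalenceReasoning

mainTheorem2 : (m : ℕ) {{nz : NonZero m}} → 3 ≤ m → (c : Fin 5)
               → (d : Setting.Coloring m)
               → (∀ t → Bijective (Setting.P m d c t))
               → IsHamiltonCycle (m ^ 5) (Setting.EArc m d c)
                 ⇔ IsSingleCycle (m ^ 4) (Setting.R m d c)
mainTheorem2 m _ = isHamiltonCycle-EArc⇔isSingleCycle-R {N = m ^ 4} {{_}} {{m^n≢0 m 4}}
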